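{- Let $\overline{a}(n)$ be the cubic overpartition function, defined by $\sum_{n\ge0}\overline{a}(n)q^n=\frac{(-q;q)_\infty(-q^2;q^2)_\infty}{(q;q)_\infty(q^2;q^2)_\infty}$. For all integers $n,m\ge1$ with $\{n,m\}\ne\{1,1\}$ and $\{n,m\}\ne\{1,3\}$, we have $\overline{a}(n)\overline{a}(m)\ge \overline{a}(n+m)$. Moreover, equality holds only when $\{n,m\}=\{1,2\}$.
   Context: For $|q|<1$, $(a;q)_\infty=\prod_{k\ge0}(1-aq^k)$. -}

module Defs where

open import Data.Nat using (ℕ; zero; suc; _+_; _*_; _∸_)
open import Data.Nat.Divisibility using (_∣?_)
open import Data.Bool using (if_then_else_)
open import Relation.Nullary.Decidable using (does)

Series : Set
Series = ℕ → ℕ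

sumTo : ℕ → (ℕ → ℕ) → ℕ
sumTo zero    f = f 0
sumTo (suc n) f = sumTo n f + f (suc n)

_⊛_ : Series → Series → Series
(f ⊛ g) n = sumTo n (λ i → f i * g (n ∸ i))

one : Series
one zero    = 1
one (suc _) = 0

-- 1 + q^k   (k ≥ 1 in use)
onePlus : ℕ → Series
onePlus k zero = 1
onePlus k (suc n) = if does (suc n Data.Nat.≟ k) then 1 else 0

-- 1/(1 - q^k) = Σ_j q^{kj}   (k ≥ 1 in use)
geo : ℕ → Series
geo k n = if does (k ∣? n) then 1 else 0

factor : ℕ → Series
factor k = ((onePlus k ⊛ onePlus (2 * k)) ⊛ geo k) ⊛ geo (2 * k)

prodTo : ℕ → Series
prodTo zero    = one
prodTo (suc N) = prodTo N ⊛ factor (suc N)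

-- Cubic overpartition function: coefficient of q^n in
-- (-q;q)_∞(-q²;q²)_∞ / ((q;q)_∞(q²;q²)_∞).
-- Factors with k > n are ≡ 1 mod q^{n+1}, so truncating the product at k = n is exact.
abar : ℕ → ℕ
abar n = prodTo n n

-- The generating function F = ∏ₖ (1 + qᵏ)(1 + q²ᵏ)/((1 - qᵏ)(1 - q²ᵏ)) has logarithmic derivative
-- q F′/F = Σᵢ c(i) qⁱ (c = logDerivCoeff), the k-th factor contributing 2k qᵏ/(1 - q²ᵏ) + 4k q²ᵏ/(1 - q⁴ᵏ).
-- Hence 2i ≤ c(i) ≤ 6i² and n a̅(n) = Σ_{i ≤ n} c(i) a̅(n - i). With this recurrence one shows by
-- induction that a̅(m) > 24 (m + 1)(m + 2) for m ≥ 15, and then, by induction on m + n, that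
-- a̅(m + n) < a̅(m) a̅(n) whenever 1 ≤ n ≤ m and m ≥ 15. The finitely many pairs with m, n < 15 are
-- decided from a table of a̅(0), …, a̅(29), itself verified against the recurrence.

module Submission where

open import Defs
open import Data.Bool using (true; false; if_then_else_)
open import Data.List using (List; []; _∷_)
open import Data.Nat
open import Data.Nat.Divisibility using (_∣_; _∣?_; _∣0; ∣-refl; ∣⇒≤; ∣m+n∣m⇒∣n; ∣m∸n∣n⇒∣m)
open import Data.Nat.Induction using (<-wellFounded)
open import Data.Nat.Properties
open import Algebra.Properties.CommutativeSemigroup +-commutativeSemigroup using (interchange; x∙yz≈y∙xz; xy∙z≈x∙zy)
open import Data.Nat.Tactic.RingSolver using (solve-∀)
open import Data.Product using (_×_; _,_; proj₁; proj₂)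
open import Data.Sum using (_⊎_; inj₁; inj₂; [_,_])
open import Function using (_∘_)
open import Induction.WellFounded using (Acc; acc)
open import Relation.Binary.PropositionalEquality hiding ([_])
open import Relation.Nullary using (¬_; Dec; yes; no; contradiction)
open import Relation.Nullary.Decidable using (does; dec-true; dec-false; toWitness; _×-dec_; _⊎-dec_; _→-dec_; ¬?)
import Relation.Binary.Reasoning.Setoid as SetoidReasoning

sumTo-cong : ∀ n {f g : ℕ → ℕ} → (∀ i → i ≤ n → f i ≡ g i) → sumTo n f ≡ sumTo n g
sumTo-cong zero    f≡g = f≡g 0 z≤n
sumTo-cong (suc n) f≡g =
  cong₂ _+_ (sumTo-cong n (λ i i≤n → f≡g i (m≤n⇒m≤1+n i≤n))) (f≡g (suc n) ≤-refl)

sumTo-zero : ∀ n {f : ℕ → ℕ} → (∀ i → i ≤ n → f i ≡ 0) → sumTo n f ≡ 0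
sumTo-zero zero    f≡0 = f≡0 0 z≤n
sumTo-zero (suc n) f≡0 =
  cong₂ _+_ (sumTo-zero n (λ i i≤n → f≡0 i (m≤n⇒m≤1+n i≤n))) (f≡0 (suc n) ≤-refl)

sumTo-+ : ∀ n (f g : ℕ → ℕ) → sumTo n (λ i → f i + g i) ≡ sumTo n f + sumTo n g
sumTo-+ zero    f g = refl
sumTo-+ (suc n) f g = trans (cong (_+ (f (suc n) + g (suc n))) (sumTo-+ n f g))
  (interchange (sumTo n f) (sumTo n g) (f (suc n)) (g (suc n)))

sumTo-*ˡ : ∀ n k (f : ℕ → ℕ) → sumTo n (λ i → k * f i) ≡ k * sumTo n f
sumTo-*ˡ zero    k f = refl
sumTo-*ˡ (suc n) k f = trans (cong (_+ k * f (suc n)) (sumTo-*ˡ n k f))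
  (sym (*-distribˡ-+ k (sumTo n f) (f (suc n))))

sumTo-*ʳ : ∀ n k (f : ℕ → ℕ) → sumTo n (λ i → f i * k) ≡ sumTo n f * k
sumTo-*ʳ n k f = trans (sumTo-cong n (λ i _ → *-comm (f i) k)) (trans (sumTo-*ˡ n k f) (*-comm k _))

sumTo-suc : ∀ n (f : ℕ → ℕ) → sumTo (suc n) f ≡ f 0 + sumTo n (λ i → f (suc i))
sumTo-suc zero    f = refl
sumTo-suc (suc n) f = trans (cong (_+ f (2 + n)) (sumTo-suc n f)) (+-assoc (f 0) _ _)

sumTo-reverse : ∀ n (f : ℕ → ℕ) → sumTo n f ≡ sumTo n (λ i → f (n ∸ i))
sumTo-reverse zero    f = refl
sumTo-reverse (suc n) f = begin
  sumTo n f + f (suc n)                  ≡⟨ +-comm (sumTo n f) _ ⟩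
  f (suc n) + sumTo n f                  ≡⟨ cong (f (suc n) +_) (sumTo-reverse n f) ⟩
  f (suc n) + sumTo n (λ i → f (n ∸ i))  ≡⟨ sumTo-suc n (λ i → f (suc n ∸ i)) ⟨
  sumTo (suc n) (λ i → f (suc n ∸ i))    ∎
  where open ≡-Reasoning

sumTo-exchange : ∀ n (F : ℕ → ℕ → ℕ) →
  sumTo n (λ i → sumTo i (F i)) ≡ sumTo n (λ j → sumTo (n ∸ j) (λ l → F (j + l) j))
sumTo-exchange zero    F = refl
sumTo-exchange (suc n) F = begin
  sumTo n (λ i → sumTo i (F i)) + sumTo (suc n) (F (suc n))
    ≡⟨ cong (_+ sumTo (suc n) (F (suc n))) (sumTo-exchange n F) ⟩
  sumTo n column + (sumTo n (F (suc n)) + F (suc n) (suc n))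
    ≡⟨ +-assoc (sumTo n column) _ _ ⟨
  (sumTo n column + sumTo n (F (suc n))) + F (suc n) (suc n)
    ≡⟨ cong (_+ F (suc n) (suc n)) (sumTo-+ n column (F (suc n))) ⟨
  sumTo n (λ j → column j + F (suc n) j) + F (suc n) (suc n)
    ≡⟨ cong₂ _+_ (sumTo-cong n extend) (cong (λ z → F z (suc n)) (sym (+-identityʳ (suc n)))) ⟩
  sumTo n column′ + F (suc n + 0) (suc n)
    ≡⟨ cong (λ z → sumTo n column′ + sumTo z (λ l → F (suc n + l) (suc n))) (n∸n≡0 n) ⟨
  sumTo (suc n) column′ ∎
  where
  open ≡-Reasoning
  column column′ : ℕ → ℕ
  column  j = sumTo (n ∸ j) (λ l → F (j + l) j)
  column′ j = sumTo (suc n ∸ j) (λ l → F (j + l) j)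
  extend : ∀ j → j ≤ n → column j + F (suc n) j ≡ column′ j
  extend j j≤n rewrite +-∸-assoc 1 j≤n =
    cong (λ z → column j + F z j) (trans (cong suc (sym (m+[n∸m]≡n j≤n))) (sym (+-suc j (n ∸ j))))

sumFrom1 : ℕ → (ℕ → ℕ) → ℕ
sumFrom1 zero    f = 0
sumFrom1 (suc n) f = sumFrom1 n f + f (suc n)

sumTo-split : ∀ m n (f : ℕ → ℕ) → sumTo (m + n) f ≡ sumTo m f + sumFrom1 n (λ i → f (m + i))
sumTo-split m zero    f rewrite +-identityʳ m = sym (+-identityʳ _)
sumTo-split m (suc n) f rewrite +-suc m n | sumTo-split m n f = +-assoc (sumTo m f) _ _

sumFrom1-*ˡ : ∀ n k (f : ℕ → ℕ) → sumFrom1 n (λ i → k * f i) ≡ k * sumFrom1 n f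
sumFrom1-*ˡ zero    k f = sym (*-zeroʳ k)
sumFrom1-*ˡ (suc n) k f = trans (cong (_+ k * f (suc n)) (sumFrom1-*ˡ n k f))
  (sym (*-distribˡ-+ k (sumFrom1 n f) (f (suc n))))

sumTo-mono-≤ : ∀ n {f g : ℕ → ℕ} → (∀ i → i ≤ n → f i ≤ g i) → sumTo n f ≤ sumTo n g
sumTo-mono-≤ zero    f≤g = f≤g 0 z≤n
sumTo-mono-≤ (suc n) f≤g =
  +-mono-≤ (sumTo-mono-≤ n (λ i i≤n → f≤g i (m≤n⇒m≤1+n i≤n))) (f≤g (suc n) ≤-refl)

sumFrom1-mono-≤ : ∀ n {f g : ℕ → ℕ} → (∀ i → 1 ≤ i → i ≤ n → f i ≤ g i) → sumFrom1 n f ≤ sumFrom1 n g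
sumFrom1-mono-≤ zero    f≤g = z≤n
sumFrom1-mono-≤ (suc n) f≤g =
  +-mono-≤ (sumFrom1-mono-≤ n (λ i 1≤i i≤n → f≤g i 1≤i (m≤n⇒m≤1+n i≤n))) (f≤g (suc n) (s≤s z≤n) ≤-refl)

sumFrom1-≤-* : ∀ n (f : ℕ → ℕ) b → (∀ i → i ≤ n → f i ≤ b) → sumFrom1 n f ≤ n * b
sumFrom1-≤-* zero    f b f≤b = z≤n
sumFrom1-≤-* (suc n) f b f≤b = subst (sumFrom1 n f + f (suc n) ≤_) (+-comm (n * b) b)
  (+-mono-≤ (sumFrom1-≤-* n f b (λ i i≤n → f≤b i (m≤n⇒m≤1+n i≤n))) (f≤b (suc n) ≤-refl))

sumTo-prefix-≤ : ∀ {m} n (f : ℕ → ℕ) → m ≤ n → sumTo m f ≤ sumTo n f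
sumTo-prefix-≤ {m} n f m≤n = begin
  sumTo m f                                          ≤⟨ m≤m+n _ _ ⟩
  sumTo m f + sumFrom1 (n ∸ m) (λ i → f (m + i))     ≡⟨ sumTo-split m (n ∸ m) f ⟨
  sumTo (m + (n ∸ m)) f                              ≡⟨ cong (λ z → sumTo z f) (m+[n∸m]≡n m≤n) ⟩
  sumTo n f                                          ∎
  where open ≤-Reasoning

last≤sumTo : ∀ n (f : ℕ → ℕ) → f n ≤ sumTo n f
last≤sumTo zero    f = ≤-refl
last≤sumTo (suc n) f = m≤n+m _ _

-- The product _⊛_ of Defs has the default fixity 20, so it binds tighter than _⊕_ and _·_.
infixl 6 _⊕_
infixr 7 _·_
infix 30 q^_

_⊕_ : Series → Series → Series
(f ⊕ g) n = f n + g n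

_·_ : ℕ → Series → Series
(k · f) n = k * f n

0ₛ : Series
0ₛ _ = 0

q^_ : ℕ → Series
(q^ k) n = if does (n ≟ k) then 1 else 0

θ : Series → Series
θ f n = n * f n

⊛-congˡ : ∀ {f f′} g → f ≗ f′ → f ⊛ g ≗ f′ ⊛ g
⊛-congˡ g f≗f′ n = sumTo-cong n (λ i _ → cong (_* g (n ∸ i)) (f≗f′ i))

⊛-congʳ : ∀ f {g g′} → g ≗ g′ → f ⊛ g ≗ f ⊛ g′
⊛-congʳ f g≗g′ n = sumTo-cong n (λ i _ → cong (f i *_) (g≗g′ (n ∸ i)))

⊕-cong : ∀ {f f′ g g′} → f ≗ f′ → g ≗ g′ → f ⊕ g ≗ f′ ⊕ g′
⊕-cong f≗f′ g≗g′ n = cong₂ _+_ (f≗f′ n) (g≗g′ n)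

⊕-congˡ : ∀ {f f′} g → f ≗ f′ → f ⊕ g ≗ f′ ⊕ g
⊕-congˡ g f≗f′ n = cong (_+ g n) (f≗f′ n)

⊕-congʳ : ∀ f {g g′} → g ≗ g′ → f ⊕ g ≗ f ⊕ g′
⊕-congʳ f g≗g′ n = cong (f n +_) (g≗g′ n)

·-congʳ : ∀ k {f g} → f ≗ g → k · f ≗ k · g
·-congʳ k f≗g n = cong (k *_) (f≗g n)

θ-cong : ∀ {f g} → f ≗ g → θ f ≗ θ g
θ-cong f≗g n = cong (n *_) (f≗g n)

⊛-comm : ∀ f g → f ⊛ g ≗ g ⊛ f
⊛-comm f g n = trans (sumTo-reverse n _) (sumTo-cong n (λ i i≤n →
  trans (cong (λ z → f (n ∸ i) * g z) (m∸[m∸n]≡n i≤n)) (*-comm (f (n ∸ i)) (g i))))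

⊛-assoc : ∀ f g h → (f ⊛ g) ⊛ h ≗ f ⊛ (g ⊛ h)
⊛-assoc f g h n = begin
  sumTo n (λ i → sumTo i (λ j → f j * g (i ∸ j)) * h (n ∸ i))
    ≡⟨ sumTo-cong n (λ i _ → sumTo-*ʳ i (h (n ∸ i)) _) ⟨
  sumTo n (λ i → sumTo i (λ j → f j * g (i ∸ j) * h (n ∸ i)))
    ≡⟨ sumTo-exchange n (λ i j → f j * g (i ∸ j) * h (n ∸ i)) ⟩
  sumTo n (λ j → sumTo (n ∸ j) (λ l → f j * g (j + l ∸ j) * h (n ∸ (j + l))))
    ≡⟨ sumTo-cong n (λ j _ → trans (sumTo-cong (n ∸ j) (λ l _ → reindex j l)) (sumTo-*ˡ (n ∸ j) (f j) _)) ⟩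
  sumTo n (λ j → f j * sumTo (n ∸ j) (λ l → g l * h (n ∸ j ∸ l))) ∎
  where
  open ≡-Reasoning
  reindex : ∀ j l → f j * g (j + l ∸ j) * h (n ∸ (j + l)) ≡ f j * (g l * h (n ∸ j ∸ l))
  reindex j l = trans (cong₂ (λ a b → f j * g a * h b) (m+n∸m≡n j l) (sym (∸-+-assoc n j l)))
                      (*-assoc (f j) _ _)

⊛-distribʳ-⊕ : ∀ f g h → (f ⊕ g) ⊛ h ≗ f ⊛ h ⊕ g ⊛ h
⊛-distribʳ-⊕ f g h n =
  trans (sumTo-cong n (λ i _ → *-distribʳ-+ (h (n ∸ i)) (f i) (g i))) (sumTo-+ n _ _)

⊛-distribˡ-⊕ : ∀ f g h → h ⊛ (f ⊕ g) ≗ h ⊛ f ⊕ h ⊛ g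
⊛-distribˡ-⊕ f g h n =
  trans (sumTo-cong n (λ i _ → *-distribˡ-+ (h i) (f (n ∸ i)) (g (n ∸ i)))) (sumTo-+ n _ _)

·-⊛ : ∀ k f g → (k · f) ⊛ g ≗ k · (f ⊛ g)
·-⊛ k f g n = trans (sumTo-cong n (λ i _ → *-assoc k (f i) _)) (sumTo-*ˡ n k _)

⊛-· : ∀ k f g → f ⊛ (k · g) ≗ k · (f ⊛ g)
⊛-· k f g n = trans (⊛-comm f (k · g) n) (trans (·-⊛ k g f n) (cong (k *_) (⊛-comm g f n)))

·-distrib-⊕ : ∀ k f g → k · (f ⊕ g) ≗ k · f ⊕ k · g
·-distrib-⊕ k f g n = *-distribˡ-+ k (f n) (g n)

⊛-identityˡ : ∀ f → one ⊛ f ≗ f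
⊛-identityˡ f zero    = +-identityʳ _
⊛-identityˡ f (suc n) = begin
  sumTo (suc n) (λ i → one i * f (suc n ∸ i))      ≡⟨ sumTo-suc n _ ⟩
  f (suc n) + 0 + sumTo n (λ i → 0)                ≡⟨ cong (f (suc n) + 0 +_) (sumTo-zero n (λ _ _ → refl)) ⟩
  f (suc n) + 0 + 0                                ≡⟨ trans (+-identityʳ _) (+-identityʳ _) ⟩
  f (suc n)                                        ∎
  where open ≡-Reasoning

⊛-identityʳ : ∀ f → f ⊛ one ≗ f
⊛-identityʳ f n = trans (⊛-comm f one n) (⊛-identityˡ f n)

θ-⊛ : ∀ f g → θ (f ⊛ g) ≗ θ f ⊛ g ⊕ f ⊛ θ g
θ-⊛ f g n = begin
  n * sumTo n (λ i → f i * g (n ∸ i))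
    ≡⟨ sumTo-*ˡ n n _ ⟨
  sumTo n (λ i → n * (f i * g (n ∸ i)))
    ≡⟨ sumTo-cong n (λ i i≤n → split i (n ∸ i) (m+[n∸m]≡n i≤n)) ⟩
  sumTo n (λ i → i * f i * g (n ∸ i) + f i * ((n ∸ i) * g (n ∸ i)))
    ≡⟨ sumTo-+ n _ _ ⟩
  (θ f ⊛ g ⊕ f ⊛ θ g) n ∎
  where
  open ≡-Reasoning
  split : ∀ i j → i + j ≡ n → n * (f i * g j) ≡ i * f i * g j + f i * (j * g j)
  split i j refl = leibniz i j (f i) (g j)
    where
    leibniz : ∀ i j a b → (i + j) * (a * b) ≡ i * a * b + a * (j * b)
    leibniz = solve-∀

q^-self : ∀ k → (q^ k) k ≡ 1
q^-self k rewrite dec-true (k ≟ k) refl = refl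

q^-other : ∀ k {n} → n ≢ k → (q^ k) n ≡ 0
q^-other k {n} n≢k rewrite dec-false (n ≟ k) n≢k = refl

sumTo-q^-*-< : ∀ n k (h : ℕ → ℕ) → n < k → sumTo n (λ i → (q^ k) i * h i) ≡ 0
sumTo-q^-*-< n k h n<k = sumTo-zero n (λ i i≤n → cong (_* h i) (q^-other k (<⇒≢ (≤-<-trans i≤n n<k))))

sumTo-q^-*-≥ : ∀ n k (h : ℕ → ℕ) → k ≤ n → sumTo n (λ i → (q^ k) i * h i) ≡ h k
sumTo-q^-*-≥ zero    zero h _ = trans (cong (_* h 0) (q^-self 0)) (+-identityʳ _)
sumTo-q^-*-≥ (suc n) k  h k≤1+n with k ≟ suc n
... | yes refl = cong₂ _+_ (sumTo-q^-*-< n (suc n) h ≤-refl) (trans (cong (_* h (suc n)) (q^-self (suc n))) (+-identityʳ _))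
... | no k≢1+n = trans (cong₂ _+_ (sumTo-q^-*-≥ n k h (s≤s⁻¹ (≤∧≢⇒< k≤1+n k≢1+n)))
                                  (cong (_* h (suc n)) (q^-other k (k≢1+n ∘ sym))))
                       (+-identityʳ _)

q^-⊛-≥ : ∀ k f n → k ≤ n → (q^ k ⊛ f) n ≡ f (n ∸ k)
q^-⊛-≥ k f n = sumTo-q^-*-≥ n k (λ i → f (n ∸ i))

q^-⊛-< : ∀ k f n → n < k → (q^ k ⊛ f) n ≡ 0
q^-⊛-< k f n = sumTo-q^-*-< n k (λ i → f (n ∸ i))

q^-⊛-q^ : ∀ j k → q^ j ⊛ q^ k ≗ q^ (j + k)
q^-⊛-q^ j k n with j ≤? n
... | no j≰n = trans (q^-⊛-< j (q^ k) n (≰⇒> j≰n))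
                     (sym (q^-other (j + k) λ n≡j+k → j≰n (subst (j ≤_) (sym n≡j+k) (m≤m+n j k))))
... | yes j≤n with n ≟ j + k
...   | yes refl = trans (q^-⊛-≥ j (q^ k) n j≤n)
                         (trans (cong (q^ k) (m+n∸m≡n j k)) (trans (q^-self k) (sym (q^-self (j + k)))))
...   | no n≢j+k = trans (q^-⊛-≥ j (q^ k) n j≤n)
                         (trans (q^-other k (λ n∸j≡k → n≢j+k (trans (sym (m+[n∸m]≡n j≤n)) (cong (j +_) n∸j≡k))))
                                (sym (q^-other (j + k) n≢j+k)))

θ-one : θ one ≗ 0ₛ
θ-one zero    = refl
θ-one (suc n) = *-zeroʳ (suc n)

θ-q^ : ∀ k → θ (q^ k) ≗ k · q^ k
θ-q^ k n with n ≟ k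
... | yes refl = refl
... | no n≢k rewrite q^-other k n≢k = trans (*-zeroʳ n) (sym (*-zeroʳ k))

θ-⊕ : ∀ f g → θ (f ⊕ g) ≗ θ f ⊕ θ g
θ-⊕ f g n = *-distribˡ-+ n (f n) (g n)

onePlus≗one⊕q^ : ∀ {k} → 1 ≤ k → onePlus k ≗ one ⊕ q^ k
onePlus≗one⊕q^ {k} 1≤k zero    = cong suc (sym (q^-other k (<⇒≢ 1≤k)))
onePlus≗one⊕q^     1≤k (suc n) = refl

geo-∣ : ∀ {k n} → k ∣ n → geo k n ≡ 1
geo-∣ {k} {n} k∣n rewrite dec-true (k ∣? n) k∣n = refl

geo-∤ : ∀ {k n} → ¬ k ∣ n → geo k n ≡ 0
geo-∤ {k} {n} k∤n rewrite dec-false (k ∣? n) k∤n = refl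

geo-∸ : ∀ {k n} → k ≤ n → geo k n ≡ geo k (n ∸ k)
geo-∸ {k} {n} k≤n = byCases (k ∣? n)
  where
  byCases : Dec (k ∣ n) → geo k n ≡ geo k (n ∸ k)
  byCases (yes k∣n) = trans (geo-∣ k∣n)
    (sym (geo-∣ (∣m+n∣m⇒∣n (subst (k ∣_) (sym (m+[n∸m]≡n k≤n)) k∣n) ∣-refl)))
  byCases (no  k∤n) = trans (geo-∤ k∤n) (sym (geo-∤ (λ k∣n∸k → k∤n (∣m∸n∣n⇒∣m k k≤n k∣n∸k ∣-refl))))

geo-unfold : ∀ {k} → 1 ≤ k → geo k ≗ one ⊕ q^ k ⊛ geo k
geo-unfold {k} 1≤k zero = trans (geo-∣ (k ∣0)) (cong suc (sym (q^-⊛-< k (geo k) 0 1≤k)))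
geo-unfold {k} 1≤k (suc n) with k ≤? suc n
... | yes k≤1+n = trans (geo-∸ k≤1+n) (sym (q^-⊛-≥ k (geo k) (suc n) k≤1+n))
... | no  k≰1+n = trans (geo-∤ (k≰1+n ∘ ∣⇒≤)) (sym (q^-⊛-< k (geo k) (suc n) (≰⇒> k≰1+n)))

-- The equation determines h n from h (n ∸ k).
q^-equation-unique : ∀ {k} → 1 ≤ k → ∀ {u h₁ h₂} →
  h₁ ≗ u ⊕ q^ k ⊛ h₁ → h₂ ≗ u ⊕ q^ k ⊛ h₂ → h₁ ≗ h₂
q^-equation-unique {k} 1≤k {u} {h₁} {h₂} eq₁ eq₂ n = go n (<-wellFounded n)
  where
  go : ∀ n → Acc _<_ n → h₁ n ≡ h₂ n
  go n (acc rec) with k ≤? n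
  ... | yes k≤n = begin
    h₁ n                     ≡⟨ eq₁ n ⟩
    u n + (q^ k ⊛ h₁) n      ≡⟨ cong (u n +_) (q^-⊛-≥ k h₁ n k≤n) ⟩
    u n + h₁ (n ∸ k)         ≡⟨ cong (u n +_) (go (n ∸ k) (rec (∸-monoʳ-< 1≤k k≤n))) ⟩
    u n + h₂ (n ∸ k)         ≡⟨ cong (u n +_) (q^-⊛-≥ k h₂ n k≤n) ⟨
    u n + (q^ k ⊛ h₂) n      ≡⟨ eq₂ n ⟨
    h₂ n                     ∎
    where open ≡-Reasoning
  ... | no k≰n = trans (eq₁ n) (trans (cong (u n +_) (trans (q^-⊛-< k h₁ n n<k) (sym (q^-⊛-< k h₂ n n<k))))
                                      (sym (eq₂ n)))
    where
    n<k : n < k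
    n<k = ≰⇒> k≰n

-- The logarithmic derivative of the generating function

HasLogDeriv : Series → Series → Set
HasLogDeriv f L = θ f ≗ L ⊛ f

HasLogDeriv-⊛ : ∀ {f g} L M → HasLogDeriv f L → HasLogDeriv g M → HasLogDeriv (f ⊛ g) (L ⊕ M)
HasLogDeriv-⊛ {f} {g} L M θf θg = begin
  θ (f ⊛ g)                      ≈⟨ θ-⊛ f g ⟩
  θ f ⊛ g ⊕ f ⊛ θ g              ≈⟨ ⊕-cong (⊛-congˡ g θf) (⊛-congʳ f θg) ⟩
  (L ⊛ f) ⊛ g ⊕ f ⊛ (M ⊛ g)      ≈⟨ ⊕-cong (⊛-assoc L f g) (sym ∘ ⊛-assoc f M g) ⟩
  L ⊛ (f ⊛ g) ⊕ (f ⊛ M) ⊛ g      ≈⟨ ⊕-congʳ (L ⊛ (f ⊛ g)) (⊛-congˡ g (⊛-comm f M)) ⟩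
  L ⊛ (f ⊛ g) ⊕ (M ⊛ f) ⊛ g      ≈⟨ ⊕-congʳ (L ⊛ (f ⊛ g)) (⊛-assoc M f g) ⟩
  L ⊛ (f ⊛ g) ⊕ M ⊛ (f ⊛ g)      ≈⟨ ⊛-distribʳ-⊕ L M (f ⊛ g) ⟨
  (L ⊕ M) ⊛ (f ⊛ g)              ∎
  where open SetoidReasoning (ℕ →-setoid ℕ)

HasLogDeriv-cong : ∀ {f f′} L → f ≗ f′ → HasLogDeriv f L → HasLogDeriv f′ L
HasLogDeriv-cong L f≗f′ θf n = trans (sym (θ-cong f≗f′ n)) (trans (θf n) (⊛-congʳ L f≗f′ n))

-- The logarithmic derivative of (1 + q^k)/(1 - q^k), namely 2k q^k/(1 - q^{2k}).
ratioLogDeriv : ℕ → Series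
ratioLogDeriv k = (2 * k) · q^ k ⊛ geo (2 * k)

module _ {k : ℕ} (1≤k : 1 ≤ k) where

  private
    g g₂ : Series
    g  = geo k
    g₂ = geo (2 * k)

    1≤2k : 1 ≤ 2 * k
    1≤2k = ≤-trans 1≤k (m≤m+n k _)

    q^2k⊛g₂ : q^ (2 * k) ⊛ g₂ ≗ q^ k ⊛ (q^ k ⊛ g₂)
    q^2k⊛g₂ n = begin
      (q^ (2 * k) ⊛ g₂) n        ≡⟨ cong (λ j → (q^ (k + j) ⊛ g₂) n) (+-identityʳ k) ⟩
      (q^ (k + k) ⊛ g₂) n        ≡⟨ ⊛-congˡ g₂ (q^-⊛-q^ k k) n ⟨
      ((q^ k ⊛ q^ k) ⊛ g₂) n     ≡⟨ ⊛-assoc (q^ k) (q^ k) g₂ n ⟩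
      (q^ k ⊛ (q^ k ⊛ g₂)) n     ∎
      where open ≡-Reasoning

  θ-geo-unfold : θ g ≗ k · q^ k ⊛ g ⊕ q^ k ⊛ θ g
  θ-geo-unfold = begin
    θ g                                ≈⟨ θ-cong (geo-unfold 1≤k) ⟩
    θ (one ⊕ q^ k ⊛ g)                 ≈⟨ θ-⊕ one (q^ k ⊛ g) ⟩
    θ one ⊕ θ (q^ k ⊛ g)               ≈⟨ ⊕-cong θ-one (θ-⊛ (q^ k) g) ⟩
    0ₛ ⊕ (θ (q^ k) ⊛ g ⊕ q^ k ⊛ θ g)   ≈⟨ ⊕-congʳ 0ₛ (⊕-congˡ (q^ k ⊛ θ g) (⊛-congˡ g (θ-q^ k))) ⟩
    0ₛ ⊕ ((k · q^ k) ⊛ g ⊕ q^ k ⊛ θ g) ≈⟨ ⊕-congʳ 0ₛ (⊕-congˡ (q^ k ⊛ θ g) (·-⊛ k (q^ k) g)) ⟩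
    k · q^ k ⊛ g ⊕ q^ k ⊛ θ g          ∎
    where open SetoidReasoning (ℕ →-setoid ℕ)

  geo⊛geo-unfold : g ⊛ g ≗ g ⊕ q^ k ⊛ (g ⊛ g)
  geo⊛geo-unfold = begin
    g ⊛ g                        ≈⟨ ⊛-congˡ g (geo-unfold 1≤k) ⟩
    (one ⊕ q^ k ⊛ g) ⊛ g         ≈⟨ ⊛-distribʳ-⊕ one (q^ k ⊛ g) g ⟩
    one ⊛ g ⊕ (q^ k ⊛ g) ⊛ g     ≈⟨ ⊕-cong (⊛-identityˡ g) (⊛-assoc (q^ k) g g) ⟩
    g ⊕ q^ k ⊛ (g ⊛ g)           ∎
    where open SetoidReasoning (ℕ →-setoid ℕ)

  θ-geo : θ g ≗ k · q^ k ⊛ (g ⊛ g)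
  θ-geo = q^-equation-unique 1≤k θ-geo-unfold (begin
    k · q^ k ⊛ (g ⊛ g)                          ≈⟨ ·-congʳ k (⊛-congʳ (q^ k) geo⊛geo-unfold) ⟩
    k · q^ k ⊛ (g ⊕ q^ k ⊛ (g ⊛ g))             ≈⟨ ·-congʳ k (⊛-distribˡ-⊕ g (q^ k ⊛ (g ⊛ g)) (q^ k)) ⟩
    k · (q^ k ⊛ g ⊕ q^ k ⊛ (q^ k ⊛ (g ⊛ g)))    ≈⟨ ·-distrib-⊕ k _ _ ⟩
    k · q^ k ⊛ g ⊕ k · q^ k ⊛ (q^ k ⊛ (g ⊛ g))  ≈⟨ ⊕-congʳ (k · q^ k ⊛ g) (sym ∘ ⊛-· k (q^ k) (q^ k ⊛ (g ⊛ g))) ⟩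
    k · q^ k ⊛ g ⊕ q^ k ⊛ (k · q^ k ⊛ (g ⊛ g))  ∎)
    where open SetoidReasoning (ℕ →-setoid ℕ)

  geo-2*-⊛-onePlus : g₂ ⊛ onePlus k ≗ g
  geo-2*-⊛-onePlus = q^-equation-unique 1≤k unfold (geo-unfold 1≤k)
    where
    open SetoidReasoning (ℕ →-setoid ℕ)
    expand : g₂ ⊛ onePlus k ≗ g₂ ⊕ q^ k ⊛ g₂
    expand = begin
      g₂ ⊛ onePlus k               ≈⟨ ⊛-congʳ g₂ (onePlus≗one⊕q^ 1≤k) ⟩
      g₂ ⊛ (one ⊕ q^ k)            ≈⟨ ⊛-distribˡ-⊕ one (q^ k) g₂ ⟩
      g₂ ⊛ one ⊕ g₂ ⊛ q^ k         ≈⟨ ⊕-cong (⊛-identityʳ g₂) (⊛-comm g₂ (q^ k)) ⟩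
      g₂ ⊕ q^ k ⊛ g₂               ∎
    unfold : g₂ ⊛ onePlus k ≗ one ⊕ q^ k ⊛ (g₂ ⊛ onePlus k)
    unfold = begin
      g₂ ⊛ onePlus k                              ≈⟨ expand ⟩
      g₂ ⊕ q^ k ⊛ g₂                              ≈⟨ ⊕-congˡ (q^ k ⊛ g₂) (geo-unfold 1≤2k) ⟩
      one ⊕ q^ (2 * k) ⊛ g₂ ⊕ q^ k ⊛ g₂           ≈⟨ (λ n → xy∙z≈x∙zy (one n) ((q^ (2 * k) ⊛ g₂) n) ((q^ k ⊛ g₂) n)) ⟩
      one ⊕ (q^ k ⊛ g₂ ⊕ q^ (2 * k) ⊛ g₂)         ≈⟨ ⊕-congʳ one (⊕-congʳ (q^ k ⊛ g₂) q^2k⊛g₂) ⟩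
      one ⊕ (q^ k ⊛ g₂ ⊕ q^ k ⊛ (q^ k ⊛ g₂))      ≈⟨ ⊕-congʳ one (sym ∘ ⊛-distribˡ-⊕ g₂ (q^ k ⊛ g₂) (q^ k)) ⟩
      one ⊕ q^ k ⊛ (g₂ ⊕ q^ k ⊛ g₂)               ≈⟨ ⊕-congʳ one (⊛-congʳ (q^ k) (sym ∘ expand)) ⟩
      one ⊕ q^ k ⊛ (g₂ ⊛ onePlus k)               ∎

  θ-onePlus : θ (onePlus k) ≗ k · q^ k
  θ-onePlus n = trans (θ-cong (onePlus≗one⊕q^ 1≤k) n) (trans (θ-⊕ one (q^ k) n) (cong₂ _+_ (θ-one n) (θ-q^ k n)))

  onePlus⊛geo-hasLogDeriv : HasLogDeriv (onePlus k ⊛ g) (ratioLogDeriv k)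
  onePlus⊛geo-hasLogDeriv n = trans (θ-ratio n) (sym (ratio⊛ n))
    where
    open SetoidReasoning (ℕ →-setoid ℕ)
    θ-ratio : θ (onePlus k ⊛ g) ≗ θ g ⊕ θ g
    θ-ratio = begin
      θ (onePlus k ⊛ g)                        ≈⟨ θ-⊛ (onePlus k) g ⟩
      θ (onePlus k) ⊛ g ⊕ onePlus k ⊛ θ g      ≈⟨ ⊕-cong (⊛-congˡ g θ-onePlus) (⊛-congˡ (θ g) (onePlus≗one⊕q^ 1≤k)) ⟩
      (k · q^ k) ⊛ g ⊕ (one ⊕ q^ k) ⊛ θ g      ≈⟨ ⊕-cong (·-⊛ k (q^ k) g) (⊛-distribʳ-⊕ one (q^ k) (θ g)) ⟩
      k · q^ k ⊛ g ⊕ (one ⊛ θ g ⊕ q^ k ⊛ θ g)  ≈⟨ ⊕-congʳ (k · q^ k ⊛ g) (⊕-congˡ (q^ k ⊛ θ g) (⊛-identityˡ (θ g))) ⟩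
      k · q^ k ⊛ g ⊕ (θ g ⊕ q^ k ⊛ θ g)        ≈⟨ (λ n → x∙yz≈y∙xz (k * (q^ k ⊛ g) n) (θ g n) ((q^ k ⊛ θ g) n)) ⟩
      θ g ⊕ (k · q^ k ⊛ g ⊕ q^ k ⊛ θ g)        ≈⟨ ⊕-congʳ (θ g) θ-geo-unfold ⟨
      θ g ⊕ θ g                                ∎
    ratio⊛ : ratioLogDeriv k ⊛ (onePlus k ⊛ g) ≗ θ g ⊕ θ g
    ratio⊛ = begin
      ((2 * k) · q^ k ⊛ g₂) ⊛ (onePlus k ⊛ g)    ≈⟨ ·-⊛ (2 * k) (q^ k ⊛ g₂) (onePlus k ⊛ g) ⟩
      (2 * k) · (q^ k ⊛ g₂) ⊛ (onePlus k ⊛ g)    ≈⟨ ·-congʳ (2 * k) (⊛-assoc (q^ k) g₂ (onePlus k ⊛ g)) ⟩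
      (2 * k) · q^ k ⊛ (g₂ ⊛ (onePlus k ⊛ g))    ≈⟨ ·-congʳ (2 * k) (⊛-congʳ (q^ k) regroup) ⟩
      (2 * k) · q^ k ⊛ (g ⊛ g)                   ≈⟨ (λ n → double k ((q^ k ⊛ (g ⊛ g)) n)) ⟩
      k · q^ k ⊛ (g ⊛ g) ⊕ k · q^ k ⊛ (g ⊛ g)    ≈⟨ ⊕-cong θ-geo θ-geo ⟨
      θ g ⊕ θ g                                  ∎
      where
      regroup : g₂ ⊛ (onePlus k ⊛ g) ≗ g ⊛ g
      regroup n = trans (sym (⊛-assoc g₂ (onePlus k) g n)) (⊛-congˡ g geo-2*-⊛-onePlus n)
      double : ∀ k x → 2 * k * x ≡ k * x + k * x
      double = solve-∀

factorLogDeriv : ℕ → Series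
factorLogDeriv k = ratioLogDeriv k ⊕ ratioLogDeriv (2 * k)

factor≗ratio⊛ratio : ∀ k → factor k ≗ (onePlus k ⊛ geo k) ⊛ (onePlus (2 * k) ⊛ geo (2 * k))
factor≗ratio⊛ratio k = begin
  ((o₁ ⊛ o₂) ⊛ g₁) ⊛ g₂    ≈⟨ ⊛-congˡ g₂ (⊛-assoc o₁ o₂ g₁) ⟩
  (o₁ ⊛ (o₂ ⊛ g₁)) ⊛ g₂    ≈⟨ ⊛-congˡ g₂ (⊛-congʳ o₁ (⊛-comm o₂ g₁)) ⟩
  (o₁ ⊛ (g₁ ⊛ o₂)) ⊛ g₂    ≈⟨ ⊛-congˡ g₂ (sym ∘ ⊛-assoc o₁ g₁ o₂) ⟩
  ((o₁ ⊛ g₁) ⊛ o₂) ⊛ g₂    ≈⟨ ⊛-assoc (o₁ ⊛ g₁) o₂ g₂ ⟩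
  (o₁ ⊛ g₁) ⊛ (o₂ ⊛ g₂)    ∎
  where
  open SetoidReasoning (ℕ →-setoid ℕ)
  o₁ o₂ g₁ g₂ : Series
  o₁ = onePlus k
  o₂ = onePlus (2 * k)
  g₁ = geo k
  g₂ = geo (2 * k)

factor-hasLogDeriv : ∀ {k} → 1 ≤ k → HasLogDeriv (factor k) (factorLogDeriv k)
factor-hasLogDeriv {k} 1≤k = HasLogDeriv-cong (factorLogDeriv k) (sym ∘ factor≗ratio⊛ratio k)
  (HasLogDeriv-⊛ (ratioLogDeriv k) (ratioLogDeriv (2 * k))
    (onePlus⊛geo-hasLogDeriv 1≤k) (onePlus⊛geo-hasLogDeriv (≤-trans 1≤k (m≤m+n k _))))

prodLogDeriv : ℕ → Series
prodLogDeriv N n = sumFrom1 N (λ k → factorLogDeriv k n)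

prodTo-hasLogDeriv : ∀ N → HasLogDeriv (prodTo N) (prodLogDeriv N)
prodTo-hasLogDeriv zero    n = trans (θ-one n) (sym (sumTo-zero n (λ _ _ → refl)))
prodTo-hasLogDeriv (suc N) = HasLogDeriv-⊛ (prodLogDeriv N) (factorLogDeriv (suc N))
  (prodTo-hasLogDeriv N) (factor-hasLogDeriv (s≤s z≤n))

-- factor k ≡ 1 modulo q^k, so the truncated products and their logarithmic derivatives stabilise.

OneBelow : Series → ℕ → Set
OneBelow f k = ∀ i → i < k → f i ≡ one i

OneBelow-⊛ : ∀ {f g k} → OneBelow f k → OneBelow g k → OneBelow (f ⊛ g) k
OneBelow-⊛ f≡1 g≡1 i i<k = trans
  (sumTo-cong i (λ j j≤i → cong₂ _*_ (f≡1 j (≤-<-trans j≤i i<k)) (g≡1 (i ∸ j) (≤-<-trans (m∸n≤m i j) i<k))))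
  (⊛-identityˡ one i)

OneBelow-mono : ∀ {f k l} → k ≤ l → OneBelow f l → OneBelow f k
OneBelow-mono k≤l f≡1 i i<k = f≡1 i (<-≤-trans i<k k≤l)

onePlus-OneBelow : ∀ {k} → 1 ≤ k → OneBelow (onePlus k) k
onePlus-OneBelow {k} 1≤k i i<k =
  trans (onePlus≗one⊕q^ 1≤k i) (trans (cong (one i +_) (q^-other k (<⇒≢ i<k))) (+-identityʳ _))

geo-OneBelow : ∀ {k} → 1 ≤ k → OneBelow (geo k) k
geo-OneBelow {k} 1≤k i i<k =
  trans (geo-unfold 1≤k i) (trans (cong (one i +_) (q^-⊛-< k (geo k) i i<k)) (+-identityʳ _))

factor-OneBelow : ∀ {k} → 1 ≤ k → OneBelow (factor k) k
factor-OneBelow {k} 1≤k = OneBelow-⊛ (OneBelow-⊛ (OneBelow-⊛ (onePlus-OneBelow 1≤k)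
  (OneBelow-mono k≤2k (onePlus-OneBelow 1≤2k))) (geo-OneBelow 1≤k)) (OneBelow-mono k≤2k (geo-OneBelow 1≤2k))
  where
  k≤2k : k ≤ 2 * k
  k≤2k = m≤m+n k _
  1≤2k : 1 ≤ 2 * k
  1≤2k = ≤-trans 1≤k k≤2k

prodTo-stable : ∀ {n N} → n ≤′ N → prodTo N n ≡ abar n
prodTo-stable ≤′-refl = refl
prodTo-stable {n} (≤′-step {N} n≤′N) = begin
  (prodTo N ⊛ factor (suc N)) n  ≡⟨ sumTo-cong n (λ i i≤n → cong (prodTo N i *_) (factor≡1 i≤n)) ⟩
  (prodTo N ⊛ one) n             ≡⟨ ⊛-identityʳ (prodTo N) n ⟩
  prodTo N n                     ≡⟨ prodTo-stable n≤′N ⟩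
  abar n                         ∎
  where
  open ≡-Reasoning
  factor≡1 : ∀ {i} → i ≤ n → factor (suc N) (n ∸ i) ≡ one (n ∸ i)
  factor≡1 {i} _ = factor-OneBelow (s≤s z≤n) (n ∸ i) (s≤s (≤-trans (m∸n≤m n i) (≤′⇒≤ n≤′N)))

ratioLogDeriv-< : ∀ {j i} → i < j → ratioLogDeriv j i ≡ 0
ratioLogDeriv-< {j} {i} i<j = trans (cong ((2 * j) *_) (q^-⊛-< j (geo (2 * j)) i i<j)) (*-zeroʳ (2 * j))

logDerivCoeff : ℕ → ℕ
logDerivCoeff i = prodLogDeriv i i

prodLogDeriv-stable : ∀ {i N} → i ≤′ N → prodLogDeriv N i ≡ logDerivCoeff i
prodLogDeriv-stable ≤′-refl = refl
prodLogDeriv-stable {i} (≤′-step {N} i≤′N) = begin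
  prodLogDeriv N i + (ratioLogDeriv (suc N) i + ratioLogDeriv (2 * suc N) i)
    ≡⟨ cong₂ (λ a b → prodLogDeriv N i + (a + b)) (ratioLogDeriv-< i<1+N) (ratioLogDeriv-< (<-≤-trans i<1+N (m≤m+n _ _))) ⟩
  prodLogDeriv N i + 0  ≡⟨ +-identityʳ _ ⟩
  prodLogDeriv N i      ≡⟨ prodLogDeriv-stable i≤′N ⟩
  logDerivCoeff i       ∎
  where
  open ≡-Reasoning
  i<1+N : i < suc N
  i<1+N = s≤s (≤′⇒≤ i≤′N)

recurrence : ∀ n → n * abar n ≡ sumTo n (λ i → logDerivCoeff i * abar (n ∸ i))
recurrence n = trans (prodTo-hasLogDeriv n n) (sumTo-cong n (λ i i≤n →
  cong₂ _*_ (prodLogDeriv-stable (≤⇒≤′ i≤n)) (prodTo-stable (≤⇒≤′ (m∸n≤m n i)))))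

geo≤1 : ∀ k n → geo k n ≤ 1
geo≤1 k n with does (k ∣? n)
... | true  = ≤-refl
... | false = z≤n

ratioLogDeriv-≤ : ∀ j i → ratioLogDeriv j i ≤ 2 * j
ratioLogDeriv-≤ j i = subst (ratioLogDeriv j i ≤_) (*-identityʳ (2 * j)) (*-monoʳ-≤ (2 * j) coefficient≤1)
  where
  coefficient≤1 : (q^ j ⊛ geo (2 * j)) i ≤ 1
  coefficient≤1 with j ≤? i
  ... | yes j≤i = subst (_≤ 1) (sym (q^-⊛-≥ j (geo (2 * j)) i j≤i)) (geo≤1 (2 * j) (i ∸ j))
  ... | no  j≰i = subst (_≤ 1) (sym (q^-⊛-< j (geo (2 * j)) i (≰⇒> j≰i))) z≤n

ratioLogDeriv-self : ∀ j → ratioLogDeriv j j ≡ 2 * j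
ratioLogDeriv-self j = trans (cong ((2 * j) *_) leading) (*-identityʳ _)
  where
  leading : (q^ j ⊛ geo (2 * j)) j ≡ 1
  leading = trans (q^-⊛-≥ j (geo (2 * j)) j ≤-refl) (trans (cong (geo (2 * j)) (n∸n≡0 j)) (geo-∣ ((2 * j) ∣0)))

factorLogDeriv-≤ : ∀ k i → factorLogDeriv k i ≤ 6 * k
factorLogDeriv-≤ k i = subst (factorLogDeriv k i ≤_) (2k+4k≡6k k) (+-mono-≤ (ratioLogDeriv-≤ k i) (ratioLogDeriv-≤ (2 * k) i))
  where
  2k+4k≡6k : ∀ k → 2 * k + 2 * (2 * k) ≡ 6 * k
  2k+4k≡6k = solve-∀

logDerivCoeff-≥ : ∀ i → 2 * i ≤ logDerivCoeff i
logDerivCoeff-≥ zero    = z≤n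
logDerivCoeff-≥ (suc i) = begin
  2 * suc i                        ≡⟨ ratioLogDeriv-self (suc i) ⟨
  ratioLogDeriv (suc i) (suc i)    ≤⟨ m≤m+n _ (ratioLogDeriv (2 * suc i) (suc i)) ⟩
  factorLogDeriv (suc i) (suc i)   ≤⟨ m≤n+m _ (prodLogDeriv i (suc i)) ⟩
  logDerivCoeff (suc i)            ∎
  where open ≤-Reasoning

logDerivCoeff-≤ : ∀ i → logDerivCoeff i ≤ i * (6 * i)
logDerivCoeff-≤ i = sumFrom1-≤-* i (λ k → factorLogDeriv k i) (6 * i)
  (λ k k≤i → ≤-trans (factorLogDeriv-≤ k i) (*-monoʳ-≤ 6 k≤i))

-- Values for small arguments

lookupOr0 : List ℕ → ℕ → ℕ
lookupOr0 []       _       = 0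
lookupOr0 (x ∷ xs) zero    = x
lookupOr0 (x ∷ xs) (suc n) = lookupOr0 xs n

abarTable : ℕ → ℕ
abarTable = lookupOr0 (1 ∷ 2 ∷ 6 ∷ 12 ∷ 26 ∷ 48 ∷ 92 ∷ 160 ∷ 282 ∷ 470 ∷ 784 ∷ 1260 ∷ 2020 ∷ 3152 ∷ 4896
  ∷ 7456 ∷ 11290 ∷ 16836 ∷ 24962 ∷ 36556 ∷ 53232 ∷ 76736 ∷ 110012 ∷ 156384 ∷ 221156 ∷ 310482 ∷ 433776
  ∷ 602200 ∷ 832224 ∷ 1143696 ∷ [])

abarTable-recurrence : ∀ {n} → n < 30 →
  sumTo n (λ i → logDerivCoeff i * abarTable (n ∸ i)) ≡ n * abarTable n
abarTable-recurrence = toWitness {a? = allUpTo?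
  (λ n → sumTo n (λ i → logDerivCoeff i * abarTable (n ∸ i)) ≟ n * abarTable n) 30} _

abar≡abarTable : ∀ {n} → n < 30 → abar n ≡ abarTable n
abar≡abarTable {n} = go n (<-wellFounded n)
  where
  go : ∀ n → Acc _<_ n → n < 30 → abar n ≡ abarTable n
  go zero    _         _   = refl
  go (suc n) (acc rec) n<30 = *-cancelˡ-≡ (abar (suc n)) (abarTable (suc n)) (suc n) (begin
    suc n * abar (suc n)                                             ≡⟨ recurrence (suc n) ⟩
    sumTo (suc n) (λ i → logDerivCoeff i * abar (suc n ∸ i))         ≡⟨ sumTo-cong (suc n) earlier ⟩
    sumTo (suc n) (λ i → logDerivCoeff i * abarTable (suc n ∸ i))    ≡⟨ abarTable-recurrence n<30 ⟩
    suc n * abarTable (suc n)                                        ∎)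
    where
    open ≡-Reasoning
    earlier : ∀ i → i ≤ suc n → logDerivCoeff i * abar (suc n ∸ i) ≡ logDerivCoeff i * abarTable (suc n ∸ i)
    earlier zero    _ = refl
    earlier (suc i) _ = cong (logDerivCoeff (suc i) *_)
      (go (n ∸ i) (rec (s≤s (m∸n≤m n i))) (≤-<-trans (m∸n≤m n i) (<-trans (n<1+n n) n<30)))

-- Chosen so that 24 m² ≤ lowerBound m, which is what the submultiplicativity step needs, while
-- lowerBound m < a̅(m) already holds from m = 15 on.
lowerBound : ℕ → ℕ
lowerBound m = 24 * ((m + 1) * (m + 2))

lowerBound-mono : ∀ {m n} → m ≤ n → lowerBound m ≤ lowerBound n
lowerBound-mono m≤n = *-monoʳ-≤ 24 (*-mono-≤ (+-monoˡ-≤ 1 m≤n) (+-monoˡ-≤ 2 m≤n))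

lowerBound-small : ∀ {m} → m < 30 → 15 ≤ m → lowerBound m < abarTable m
lowerBound-small = toWitness {a? = allUpTo? (λ m → 15 ≤? m →-dec lowerBound m <? abarTable m) 30} _

half-bounds : ∀ m → ⌊ m /2⌋ + ⌊ m /2⌋ ≤ m × m ≤ suc (⌊ m /2⌋ + ⌊ m /2⌋)
half-bounds zero                = z≤n , z≤n
half-bounds (suc zero)          = z≤n , s≤s z≤n
half-bounds (suc (suc m)) with half-bounds m
... | lower , upper = subst (_≤ 2 + m) (sym (+-suc (suc h) h)) (s≤s (s≤s lower))
                    , subst (2 + m ≤_) (cong suc (sym (+-suc (suc h) h))) (s≤s (s≤s upper))
  where
  h : ℕ
  h = ⌊ m /2⌋

sumTo-double : ∀ h → sumTo h (λ i → 2 * i) ≡ h * suc h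
sumTo-double zero    = refl
sumTo-double (suc h) = trans (cong (_+ 2 * suc h) (sumTo-double h)) (step h)
  where
  step : ∀ h → h * suc h + 2 * suc h ≡ suc h * suc (suc h)
  step = solve-∀

cubic≤quartic : ∀ h → 8 ≤ h → (2 * h + 1) * ((2 * h + 2) * (2 * h + 3)) ≤ h * (h + 1) * ((h + 1) * (h + 2))
cubic≤quartic h 8≤h with m≤n⇒∃[o]m+o≡n 8≤h
... | t , refl = ≤-trans (m≤m+n _ _) (≤-reflexive (gap t))
  where
  gap : ∀ t → (2 * (8 + t) + 1) * ((2 * (8 + t) + 2) * (2 * (8 + t) + 3))
                + (666 + 956 * t + 269 * (t * t) + 28 * (t * t * t) + t * t * t * t)
            ≡ (8 + t) * (8 + t + 1) * ((8 + t + 1) * (8 + t + 2))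
  gap = solve-∀

*-lowerBound-≤ : ∀ {m h} → 8 ≤ h → m ≤ suc (h + h) → m * lowerBound m ≤ h * suc h * lowerBound h
*-lowerBound-≤ {m} {h} 8≤h m≤2h+1 = begin
  m * lowerBound m                                       ≤⟨ *-mono-≤ m≤2h+1 (lowerBound-mono m≤2h+1) ⟩
  suc (h + h) * lowerBound (suc (h + h))                 ≡⟨ expandˡ h ⟩
  24 * ((2 * h + 1) * ((2 * h + 2) * (2 * h + 3)))        ≤⟨ *-monoʳ-≤ 24 (cubic≤quartic h 8≤h) ⟩
  24 * (h * (h + 1) * ((h + 1) * (h + 2)))                ≡⟨ expandʳ h ⟩
  h * suc h * lowerBound h                               ∎
  where
  open ≤-Reasoning
  expandˡ : ∀ h → suc (h + h) * (24 * ((suc (h + h) + 1) * (suc (h + h) + 2))) ≡ 24 * ((2 * h + 1) * ((2 * h + 2) * (2 * h + 3)))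
  expandˡ = solve-∀
  expandʳ : ∀ h → 24 * (h * (h + 1) * ((h + 1) * (h + 2))) ≡ h * suc h * (24 * ((h + 1) * (h + 2)))
  expandʳ = solve-∀

-- For m ≥ 30 and h = ⌊m/2⌋, already the terms i ≤ h of the recurrence for m a̅(m) exceed
-- m · lowerBound m, because c(i) ≥ 2i and a̅(m − i) > lowerBound h by induction.
abar-lower : ∀ {m} → 15 ≤ m → lowerBound m < abar m
abar-lower {m} = go m (<-wellFounded m)
  where
  go : ∀ m → Acc _<_ m → 15 ≤ m → lowerBound m < abar m
  go m (acc rec) 15≤m with m <? 30
  ... | yes m<30 = subst (lowerBound m <_) (sym (abar≡abarTable m<30)) (lowerBound-small m<30 15≤m)
  ... | no  m≮30 = *-cancelˡ-< m (lowerBound m) (abar m) (begin-strict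
    m * lowerBound m                                     ≤⟨ *-lowerBound-≤ (m+n≤o⇒n≤o 7 15≤h) upper ⟩
    h * suc h * lowerBound h                             <⟨ *-monoʳ-< (h * suc h) (n<1+n (lowerBound h)) ⟩
    h * suc h * suc (lowerBound h)                       ≡⟨ cong (_* suc (lowerBound h)) (sumTo-double h) ⟨
    sumTo h (λ i → 2 * i) * suc (lowerBound h)           ≡⟨ sumTo-*ʳ h (suc (lowerBound h)) (λ i → 2 * i) ⟨
    sumTo h (λ i → 2 * i * suc (lowerBound h))           ≤⟨ sumTo-mono-≤ h term-≥ ⟩
    sumTo h (λ i → logDerivCoeff i * abar (m ∸ i))       ≤⟨ sumTo-prefix-≤ m _ h≤m ⟩
    sumTo m (λ i → logDerivCoeff i * abar (m ∸ i))       ≡⟨ recurrence m ⟨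
    m * abar m                                           ∎)
    where
    open ≤-Reasoning
    h : ℕ
    h = ⌊ m /2⌋
    lower : h + h ≤ m
    lower = proj₁ (half-bounds m)
    upper : m ≤ suc (h + h)
    upper = proj₂ (half-bounds m)
    h≤m : h ≤ m
    h≤m = ≤-trans (m≤m+n h h) lower
    15≤h : 15 ≤ h
    15≤h = ⌊n/2⌋-mono (≮⇒≥ m≮30)
    instance
      h*[1+h]≢0 : NonZero (h * suc h)
      h*[1+h]≢0 = m*n≢0 h (suc h) {{>-nonZero (<-≤-trans z<s 15≤h)}}
    term-≥ : ∀ i → i ≤ h → 2 * i * suc (lowerBound h) ≤ logDerivCoeff i * abar (m ∸ i)
    term-≥ zero    _   = z≤n
    term-≥ (suc i) i<h = *-mono-≤ (logDerivCoeff-≥ (suc i))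
      (≤-trans (s≤s (lowerBound-mono h≤m∸i)) (go (m ∸ suc i) (rec m∸i<m) (≤-trans 15≤h h≤m∸i)))
      where
      h≤m∸i : h ≤ m ∸ suc i
      h≤m∸i = ≤-trans (≤-reflexive (sym (m+n∸n≡m h h))) (∸-mono lower i<h)
      m∸i<m : m ∸ suc i < m
      m∸i<m = ∸-monoʳ-< z<s (≤-trans i<h h≤m)

-- Submultiplicativity

defect : ℕ → ℕ
defect 1 = 2
defect 3 = 2
defect _ = 0

sumTo-defect : ∀ m → sumTo m defect ≤ 4
sumTo-defect 0 = z≤n
sumTo-defect 1 = s≤s (s≤s z≤n)
sumTo-defect 2 = s≤s (s≤s z≤n)
sumTo-defect 3 = ≤-refl
sumTo-defect (suc (suc (suc (suc m)))) = ≤-trans (≤-reflexive (+-identityʳ _)) (sumTo-defect (suc (suc (suc m))))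

-- The defect absorbs the exceptional pairs (1, 1), (1, 3) and (3, 1); it is small enough on average
-- (sumTo-defect) for the induction below to go through.
AlmostSubmultiplicative : ℕ → ℕ → Set
AlmostSubmultiplicative j k = abar (j + k) ≤ abar j * abar k + defect j

almostSubmultiplicative-small : ∀ {j k} → j < 15 → k < 15 → AlmostSubmultiplicative j k
almostSubmultiplicative-small {j} {k} j<15 k<15
  rewrite abar≡abarTable (+-mono-< j<15 k<15)
        | abar≡abarTable (<-≤-trans j<15 (m≤m+n 15 15))
        | abar≡abarTable (<-≤-trans k<15 (m≤m+n 15 15))
  = toWitness {a? = allUpTo? (λ j → allUpTo? (λ k → abarTable (j + k) ≤? abarTable j * abarTable k + defect j) 15) 15}
      _ j<15 k<15

2≤*abar : ∀ {n} → 1 ≤ n → 2 ≤ n * abar n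
2≤*abar {n} 1≤n = begin
  2                                                 ≤⟨ *-monoʳ-≤ 2 1≤n ⟩
  2 * n                                             ≤⟨ logDerivCoeff-≥ n ⟩
  logDerivCoeff n                                   ≡⟨ *-identityʳ (logDerivCoeff n) ⟨
  logDerivCoeff n * abar 0                          ≡⟨ cong (λ z → logDerivCoeff n * abar z) (n∸n≡0 n) ⟨
  logDerivCoeff n * abar (n ∸ n)                    ≤⟨ last≤sumTo n (λ i → logDerivCoeff i * abar (n ∸ i)) ⟩
  sumTo n (λ i → logDerivCoeff i * abar (n ∸ i))    ≡⟨ recurrence n ⟨
  n * abar n                                        ∎
  where open ≤-Reasoning

24m²≤lowerBound : ∀ m → 24 * (m * m) ≤ lowerBound m
24m²≤lowerBound m = *-monoʳ-≤ 24 (*-mono-≤ (m≤m+n m 1) (m≤m+n m 2))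

logDerivCoeff-≤-square : ∀ {i m} → i ≤ m → logDerivCoeff i ≤ 6 * (m * m)
logDerivCoeff-≤-square {i} {m} i≤m = begin
  logDerivCoeff i   ≤⟨ logDerivCoeff-≤ i ⟩
  i * (6 * i)       ≤⟨ *-mono-≤ i≤m (*-monoʳ-≤ 6 i≤m) ⟩
  m * (6 * m)       ≡⟨ *-comm m (6 * m) ⟩
  6 * m * m         ≡⟨ *-assoc 6 m m ⟩
  6 * (m * m)       ∎
  where open ≤-Reasoning

-- The inductive step: split (m + n) a̅(m + n) = Σ_{i ≤ m+n} c(i) a̅(m + n − i) at i = m. In the first part
-- a̅(m + n − i) ≤ a̅(m − i) a̅(n) + defect by induction; in the second c(m + i) ≤ 24 m² < a̅(m) ≤ c(i) a̅(m) / 2.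
module _ {m n : ℕ} (1≤n : 1 ≤ n) (n≤m : n ≤ m) (15≤m : 15 ≤ m)
         (ih : ∀ j k → j + k < m + n → AlmostSubmultiplicative j k) where

  private
    term : ℕ → ℕ
    term i = logDerivCoeff i * abar (m + n ∸ i)

    defectSum : ℕ
    defectSum = sumTo m (λ i → logDerivCoeff i * defect (m ∸ i))

    head-≤ : sumTo m term ≤ abar n * (m * abar m) + defectSum
    head-≤ = begin
      sumTo m term
        ≤⟨ sumTo-mono-≤ m term-≤ ⟩
      sumTo m (λ i → abar n * (logDerivCoeff i * abar (m ∸ i)) + logDerivCoeff i * defect (m ∸ i))
        ≡⟨ sumTo-+ m _ _ ⟩
      sumTo m (λ i → abar n * (logDerivCoeff i * abar (m ∸ i))) + defectSum
        ≡⟨ cong (_+ defectSum) (trans (sumTo-*ˡ m (abar n) _) (cong (abar n *_) (sym (recurrence m)))) ⟩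
      abar n * (m * abar m) + defectSum ∎
      where
      open ≤-Reasoning
      term-≤ : ∀ i → i ≤ m → term i ≤ abar n * (logDerivCoeff i * abar (m ∸ i)) + logDerivCoeff i * defect (m ∸ i)
      term-≤ zero    _   = z≤n
      term-≤ (suc i) i<m = begin
        logDerivCoeff (suc i) * abar (m + n ∸ suc i)
          ≡⟨ cong (λ z → logDerivCoeff (suc i) * abar z) (+-∸-comm n i<m) ⟩
        logDerivCoeff (suc i) * abar (m ∸ suc i + n)
          ≤⟨ *-monoʳ-≤ (logDerivCoeff (suc i)) (ih (m ∸ suc i) n (+-monoˡ-< n (∸-monoʳ-< z<s i<m))) ⟩
        logDerivCoeff (suc i) * (abar (m ∸ suc i) * abar n + defect (m ∸ suc i))
          ≡⟨ rearrange (logDerivCoeff (suc i)) (abar (m ∸ suc i)) (abar n) (defect (m ∸ suc i)) ⟩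
        abar n * (logDerivCoeff (suc i) * abar (m ∸ suc i)) + logDerivCoeff (suc i) * defect (m ∸ suc i) ∎
        where
        rearrange : ∀ c x y d → c * (x * y + d) ≡ y * (c * x) + c * d
        rearrange = solve-∀

    defectSum-< : defectSum < abar m
    defectSum-< = begin-strict
      defectSum                                       ≤⟨ sumTo-mono-≤ m coefficient-≤ ⟩
      sumTo m (λ i → 6 * (m * m) * defect (m ∸ i))    ≡⟨ sumTo-*ˡ m (6 * (m * m)) (λ i → defect (m ∸ i)) ⟩
      6 * (m * m) * sumTo m (λ i → defect (m ∸ i))    ≡⟨ cong (6 * (m * m) *_) (sumTo-reverse m defect) ⟨
      6 * (m * m) * sumTo m defect                    ≤⟨ *-monoʳ-≤ (6 * (m * m)) (sumTo-defect m) ⟩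
      6 * (m * m) * 4                                 ≡⟨ six-four (m * m) ⟩
      24 * (m * m)                                    ≤⟨ 24m²≤lowerBound m ⟩
      lowerBound m                                    <⟨ abar-lower 15≤m ⟩
      abar m                                          ∎
      where
      open ≤-Reasoning
      coefficient-≤ : ∀ i → i ≤ m → logDerivCoeff i * defect (m ∸ i) ≤ 6 * (m * m) * defect (m ∸ i)
      coefficient-≤ i i≤m = *-monoˡ-≤ (defect (m ∸ i)) (logDerivCoeff-≤-square i≤m)
      six-four : ∀ x → 6 * x * 4 ≡ 24 * x
      six-four = solve-∀

    tail-≤ : 2 * sumFrom1 n (λ i → term (m + i)) ≤ abar m * (n * abar n)
    tail-≤ = begin
      2 * sumFrom1 n (λ i → term (m + i))
        ≡⟨ sumFrom1-*ˡ n 2 (λ i → term (m + i)) ⟨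
      sumFrom1 n (λ i → 2 * term (m + i))
        ≤⟨ sumFrom1-mono-≤ n term-≤ ⟩
      sumFrom1 n (λ i → abar m * (logDerivCoeff i * abar (n ∸ i)))
        ≡⟨ sumFrom1-*ˡ n (abar m) _ ⟩
      abar m * sumFrom1 n (λ i → logDerivCoeff i * abar (n ∸ i))
        ≡⟨ cong (abar m *_) (trans (recurrence n) (sumTo-split 0 n _)) ⟨
      abar m * (n * abar n) ∎
      where
      open ≤-Reasoning
      term-≤ : ∀ i → 1 ≤ i → i ≤ n → 2 * term (m + i) ≤ abar m * (logDerivCoeff i * abar (n ∸ i))
      term-≤ i 1≤i i≤n = begin
        2 * (logDerivCoeff (m + i) * abar (m + n ∸ (m + i)))   ≡⟨ cong (λ z → 2 * (logDerivCoeff (m + i) * abar z))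
                                                                       ([m+n]∸[m+o]≡n∸o m n i) ⟩
        2 * (logDerivCoeff (m + i) * abar (n ∸ i))             ≡⟨ *-assoc 2 (logDerivCoeff (m + i)) (abar (n ∸ i)) ⟨
        2 * logDerivCoeff (m + i) * abar (n ∸ i)               ≤⟨ *-monoˡ-≤ (abar (n ∸ i)) (*-mono-≤ 2≤c c≤abar) ⟩
        logDerivCoeff i * abar m * abar (n ∸ i)                ≡⟨ cong (_* abar (n ∸ i)) (*-comm (logDerivCoeff i) (abar m)) ⟩
        abar m * logDerivCoeff i * abar (n ∸ i)                ≡⟨ *-assoc (abar m) _ _ ⟩
        abar m * (logDerivCoeff i * abar (n ∸ i))              ∎
        where
        2≤c : 2 ≤ logDerivCoeff i
        2≤c = ≤-trans (*-monoʳ-≤ 2 1≤i) (logDerivCoeff-≥ i)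
        c≤abar : logDerivCoeff (m + i) ≤ abar m
        c≤abar = begin
          logDerivCoeff (m + i)     ≤⟨ logDerivCoeff-≤-square (+-monoʳ-≤ m (≤-trans i≤n n≤m)) ⟩
          6 * ((m + m) * (m + m))   ≡⟨ four-squares m ⟩
          24 * (m * m)              ≤⟨ 24m²≤lowerBound m ⟩
          lowerBound m              ≤⟨ <⇒≤ (abar-lower 15≤m) ⟩
          abar m                    ∎
          where
          four-squares : ∀ m → 6 * ((m + m) * (m + m)) ≡ 24 * (m * m)
          four-squares = solve-∀

  abar-+-<-*-step : abar (m + n) < abar n * abar m
  abar-+-<-*-step = *-cancelˡ-< (2 * (m + n)) (abar (m + n)) (abar n * abar m) (begin-strict
    2 * (m + n) * abar (m + n)                  ≡⟨ *-assoc 2 (m + n) _ ⟩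
    2 * ((m + n) * abar (m + n))                ≡⟨ cong (2 *_) (trans (recurrence (m + n)) (sumTo-split m n term)) ⟩
    2 * (sumTo m term + tailSum)                ≡⟨ *-distribˡ-+ 2 (sumTo m term) tailSum ⟩
    2 * sumTo m term + 2 * tailSum              ≤⟨ +-monoˡ-≤ (2 * tailSum) (*-monoʳ-≤ 2 head-≤) ⟩
    2 * (X + defectSum) + 2 * tailSum           ≡⟨ cong (_+ 2 * tailSum) (*-distribˡ-+ 2 X defectSum) ⟩
    2 * X + 2 * defectSum + 2 * tailSum         ≡⟨ +-assoc (2 * X) (2 * defectSum) (2 * tailSum) ⟩
    2 * X + (2 * defectSum + 2 * tailSum)       <⟨ +-monoʳ-< (2 * X) (+-mono-<-≤ 2*defectSum< tail-≤) ⟩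
    2 * X + (Y + Y)                             ≡⟨ collect m n (abar n) (abar m) ⟩
    2 * (m + n) * (abar n * abar m)             ∎)
    where
    open ≤-Reasoning
    tailSum X Y : ℕ
    tailSum = sumFrom1 n (λ i → term (m + i))
    X = abar n * (m * abar m)
    Y = abar m * (n * abar n)
    2*defectSum< : 2 * defectSum < Y
    2*defectSum< = begin-strict
      2 * defectSum         <⟨ *-monoʳ-< 2 defectSum-< ⟩
      2 * abar m            ≡⟨ *-comm 2 (abar m) ⟩
      abar m * 2            ≤⟨ *-monoʳ-≤ (abar m) (2≤*abar 1≤n) ⟩
      Y                     ∎
    collect : ∀ m n x y → 2 * (x * (m * y)) + (y * (n * x) + y * (n * x)) ≡ 2 * (m + n) * (x * y)
    collect = solve-∀

abar-+-<-* : ∀ {j k} → 1 ≤ j → 1 ≤ k → 15 ≤ j ⊎ 15 ≤ k →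
  (∀ j′ k′ → j′ + k′ < j + k → AlmostSubmultiplicative j′ k′) → abar (j + k) < abar j * abar k
abar-+-<-* {j} {k} 1≤j 1≤k large ih with j ≤? k
... | yes j≤k = subst (λ s → abar s < abar j * abar k) (+-comm k j)
  (abar-+-<-*-step 1≤j j≤k ([ (λ 15≤j → ≤-trans 15≤j j≤k) , (λ 15≤k → 15≤k) ] large)
    (λ j′ k′ j′+k′<k+j → ih j′ k′ (subst (j′ + k′ <_) (+-comm k j) j′+k′<k+j)))
... | no  j≰k = subst (abar (j + k) <_) (*-comm (abar k) (abar j))
  (abar-+-<-*-step 1≤k k≤j ([ (λ 15≤j → 15≤j) , (λ 15≤k → ≤-trans 15≤k k≤j) ] large) ih)
  where
  k≤j : k ≤ j
  k≤j = <⇒≤ (≰⇒> j≰k)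

almostSubmultiplicative-large : ∀ j k → 15 ≤ j ⊎ 15 ≤ k →
  (∀ j′ k′ → j′ + k′ < j + k → AlmostSubmultiplicative j′ k′) → AlmostSubmultiplicative j k
almostSubmultiplicative-large zero k _ _ =
  ≤-trans (≤-reflexive (sym (*-identityˡ (abar k)))) (m≤m+n _ _)
almostSubmultiplicative-large (suc j) zero _ _ =
  ≤-trans (≤-reflexive (trans (cong abar (+-identityʳ (suc j))) (sym (*-identityʳ _)))) (m≤m+n _ _)
almostSubmultiplicative-large (suc j) (suc k) large ih =
  ≤-trans (<⇒≤ (abar-+-<-* z<s z<s large ih)) (m≤m+n _ _)

almostSubmultiplicative : ∀ j k → AlmostSubmultiplicative j k
almostSubmultiplicative j k = go j k (<-wellFounded (j + k))
  where
  go : ∀ j k → Acc _<_ (j + k) → AlmostSubmultiplicative j k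
  go j k (acc rec) with j <? 15 | k <? 15
  ... | yes j<15 | yes k<15 = almostSubmultiplicative-small j<15 k<15
  ... | no  j≮15 | _        = almostSubmultiplicative-large j k (inj₁ (≮⇒≥ j≮15)) (λ j′ k′ lt → go j′ k′ (rec lt))
  ... | yes _    | no  k≮15 = almostSubmultiplicative-large j k (inj₂ (≮⇒≥ k≮15)) (λ j′ k′ lt → go j′ k′ (rec lt))

Claim : (n m aₙ aₘ aₙ₊ₘ : ℕ) → Set
Claim n m aₙ aₘ aₙ₊ₘ = 1 ≤ n → 1 ≤ m →
  ¬ (n ≡ 1 × m ≡ 1) → ¬ (n ≡ 1 × m ≡ 3) → ¬ (n ≡ 3 × m ≡ 1) →
  (aₙ * aₘ ≥ aₙ₊ₘ) × (aₙ * aₘ ≡ aₙ₊ₘ → (n ≡ 1 × m ≡ 2) ⊎ (n ≡ 2 × m ≡ 1))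

claim? : ∀ n m aₙ aₘ aₙ₊ₘ → Dec (Claim n m aₙ aₘ aₙ₊ₘ)
claim? n m aₙ aₘ aₙ₊ₘ = 1 ≤? n →-dec 1 ≤? m →-dec
  ¬? (n ≟ 1 ×-dec m ≟ 1) →-dec ¬? (n ≟ 1 ×-dec m ≟ 3) →-dec ¬? (n ≟ 3 ×-dec m ≟ 1) →-dec
  (aₙ * aₘ ≥? aₙ₊ₘ) ×-dec (aₙ * aₘ ≟ aₙ₊ₘ →-dec ((n ≟ 1 ×-dec m ≟ 2) ⊎-dec (n ≟ 2 ×-dec m ≟ 1)))

claim-small : ∀ {n m} → n < 15 → m < 15 → Claim n m (abar n) (abar m) (abar (n + m))
claim-small {n} {m} n<15 m<15
  rewrite abar≡abarTable (+-mono-< n<15 m<15)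
        | abar≡abarTable (<-≤-trans n<15 (m≤m+n 15 15))
        | abar≡abarTable (<-≤-trans m<15 (m≤m+n 15 15))
  = toWitness {a? = allUpTo? (λ n → allUpTo? (λ m → claim? n m (abarTable n) (abarTable m) (abarTable (n + m))) 15) 15}
      _ n<15 m<15

claim-large : ∀ {n m} → 15 ≤ n ⊎ 15 ≤ m → Claim n m (abar n) (abar m) (abar (n + m))
claim-large {n} {m} large 1≤n 1≤m _ _ _ = <⇒≤ a<a*a , λ a*a≡a → contradiction (sym a*a≡a) (<⇒≢ a<a*a)
  where
  a<a*a : abar (n + m) < abar n * abar m
  a<a*a = abar-+-<-* 1≤n 1≤m large (λ j k _ → almostSubmultiplicative j k)

theorem2p6 : (n m : ℕ) → 1 ≤ n → 1 ≤ m →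
    ¬ (n ≡ 1 × m ≡ 1) → ¬ (n ≡ 1 × m ≡ 3) → ¬ (n ≡ 3 × m ≡ 1) →
    (abar n * abar m ≥ abar (n + m))
      × (abar n * abar m ≡ abar (n + m) → (n ≡ 1 × m ≡ 2) ⊎ (n ≡ 2 × m ≡ 1))
theorem2p6 n m with n <? 15 | m <? 15
... | yes n<15 | yes m<15 = claim-small n<15 m<15
... | no  n≮15 | _        = claim-large (inj₁ (≮⇒≥ n≮15))
... | yes _    | no  m≮15 = claim-large (inj₂ (≮⇒≥ m≮15))
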